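{- Let $\Sigma$ be an alphabet with at least two symbols. There exists an adversary for the $2 \times 3$ grid (two columns, three rows) over $\Sigma$: a strategy that answers, adaptively, each query of a previously unqueried cell with a symbol of $\Sigma$, such that for every order in which the cells are queried, after each query that leaves at least one cell unread, the answers given so far can be extended to a coloring of the six cells whose grid graph contains a cycle and also to a coloring whose grid graph is acyclic.
   Context: For a coloring $c : [m] \times [n] \to \Sigma$, the grid graph $G_c$ has vertex set $[m] \times [n]$ and an edge between $(i,j)$ and $(i',j')$ iff $|i-i'|+|j-j'|=1$ and $c(i,j)=c(i',j')$. The query order may be chosen adaptively by the querier depending on previous answers. -}

module Defs where

open import Data.Nat using (ℕ; _≤_; _<_; ∣_-_∣; _+_)
open import Data.Fin using (Fin; toℕ)
open import Data.Product using (_×_; _,_; ∃)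
open import Data.List using (List; []; _∷_; _++_; [_]; length)
open import Data.List.Relation.Unary.All using (All)
open import Data.List.Relation.Unary.Unique.Propositional using (Unique)
open import Data.List.Relation.Unary.Linked using (Linked)
open import Relation.Binary.PropositionalEquality using (_≡_)
open import Relation.Nullary using (¬_)

-- Cells of the grid [m] × [n] (0-indexed): (row , column).
Cell : ℕ → ℕ → Set
Cell m n = Fin m × Fin n

-- The 2 × 3 grid: three rows, two columns.
Cell₃₂ : Set
Cell₃₂ = Cell 3 2

GridAdj : ∀ {m n} → Cell m n → Cell m n → Set
GridAdj (i , j) (i' , j') = ∣ toℕ i - toℕ i' ∣ + ∣ toℕ j - toℕ j' ∣ ≡ 1

Edge : ∀ {m n} {Σ : Set} → (Cell m n → Σ) → Cell m n → Cell m n → Set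
Edge c u v = GridAdj u v × c u ≡ c v

HasCycle : ∀ {m n} {Σ : Set} → (Cell m n → Σ) → Set
HasCycle {m} {n} c =
  ∃ λ (v : Cell m n) → ∃ λ (vs : List (Cell m n)) →
    (2 ≤ length vs) × Unique (v ∷ vs) × Linked (Edge c) (v ∷ vs ++ [ v ])

Acyclic : ∀ {m n} {Σ : Set} → (Cell m n → Σ) → Set
Acyclic c = ¬ HasCycle c

-- An adversary: given the history of (query , answer) pairs so far
-- (oldest first) and the newly queried cell, it returns an answer.
Adversary : Set → Set
Adversary Σ = List (Cell₃₂ × Σ) → Cell₃₂ → Σ

runFrom : ∀ {Σ : Set} → Adversary Σ → List (Cell₃₂ × Σ) → List Cell₃₂ → List (Cell₃₂ × Σ)
runFrom A h [] = h
runFrom A h (q ∷ qs) = runFrom A (h ++ [ (q , A h q) ]) qs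

run : ∀ {Σ : Set} → Adversary Σ → List Cell₃₂ → List (Cell₃₂ × Σ)
run A qs = runFrom A [] qs

Extends : ∀ {Σ : Set} → (Cell₃₂ → Σ) → List (Cell₃₂ × Σ) → Set
Extends c h = All (λ p → c (Data.Product.proj₁ p) ≡ Data.Product.proj₂ p) h

-- A cycle of G_c visits at least three cells, hence a corner (a cell of an outer row), and a
-- corner has only two grid neighbours, so both lie on the cycle and share its colour. Applying
-- this to the corner and to the other cell of its row shows that G_c has a cycle exactly when one
-- of the two unit squares (an outer row together with the middle row) is monochromatic.
-- The adversary answers a in the middle row and at the first query of each outer row; the second
-- cell of an outer row gets b exactly when the opposite outer row is still incomplete. So at most
-- one outer row ever holds a b, and completing with a yields a monochromatic square. An outer row
-- is completed with a's only after the opposite one, so while some cell is unread we can colour an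
-- unread middle cell, or else the unread corners, with b and break both squares.
module Submission where

open import Defs
open import Data.Nat using (_<_; _≤_)
open import Data.Product using (Σ-syntax; _×_)
open import Data.List using (List; length)
open import Data.List.Relation.Unary.Unique.Propositional using (Unique)
open import Relation.Binary.PropositionalEquality using (_≢_)

open import Data.Bool using (if_then_else_)
open import Data.Empty using (⊥-elim)
open import Data.Fin as Fin using (Fin; zero; suc; toℕ)
open import Data.Fin.Properties using (all?)
open import Data.List using ([]; _∷_; _++_; [_]; _∷ʳ_; map)
open import Data.List.Properties using (++-assoc; ++-identityʳ; map-++)
open import Data.List.Membership.Propositional using (_∈_)
open import Data.List.Membership.Propositional.Properties
  using (∈-cartesianProduct⁺; ∈-allFin; ∈-map⁻; ∈-∃++; ∈-++⁺ˡ; ∈-++⁺ʳ; ∈-++⁻)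
open import Data.List.Membership.Propositional.Properties.WithK using (unique∧set⇒bag)
open import Data.List.Relation.Binary.BagAndSetEquality using (∼bag⇒↭)
open import Data.List.Relation.Binary.Permutation.Propositional using (_↭_; ↭⇒↭ₛ)
open import Data.List.Relation.Binary.Permutation.Propositional.Properties using (++-comm; ↭-length)
open import Data.List.Relation.Unary.All as All using (All; []; _∷_)
import Data.List.Relation.Unary.All.Properties as All
open import Data.List.Relation.Unary.AllPairs using ([]; _∷_)
open import Data.List.Relation.Unary.Any using (here; there)
open import Data.List.Relation.Unary.Linked using (Linked; []; [-]; _∷_)
open import Data.List.Relation.Unary.Unique.Propositional.Properties using (cartesianProduct⁺; allFin⁺)
open import Data.Nat using (s≤s; z≤n; _+_)
open import Data.Nat.Properties using (∣-∣-comm; suc-injective; <⇒≢)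
open import Data.Product using (_,_; proj₁; proj₂; ∃; ∃₂)
open import Data.Product.Properties using (≡-dec)
open import Data.Sum using (_⊎_; inj₁; inj₂) renaming ([_,_] to either)
open import Function using (_∘_; id)
open import Function.Bundles using (mk⇔)
open import Relation.Binary.Definitions using (DecidableEquality)
open import Relation.Binary.PropositionalEquality
  using (_≡_; refl; sym; trans; cong; cong₂; subst; setoid; module ≡-Reasoning)
open import Relation.Nullary using (Dec; yes; no; does; ¬_; ¬?; contradiction)
open import Relation.Nullary.Decidable using (_×-dec_; decidable-stable; dec-true; dec-false)

open import Data.List.Relation.Binary.Permutation.Setoid.Properties (setoid Cell₃₂) using (Unique-resp-↭)

module _ {A : Set} {R : A → A → Set} where

  Linked-split : ∀ xs {y ys} → Linked R (xs ++ y ∷ ys) → Linked R (xs ++ [ y ]) × Linked R (y ∷ ys)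
  Linked-split [] walk = [-] , walk
  Linked-split (_ ∷ []) (r ∷ walk) = r ∷ [-] , walk
  Linked-split (_ ∷ x ∷ xs) (r ∷ walk) with Linked-split (x ∷ xs) walk
  ... | front , back = r ∷ front , back

  Linked-join : ∀ xs {y ys} → Linked R (xs ++ [ y ]) → Linked R (y ∷ ys) → Linked R (xs ++ y ∷ ys)
  Linked-join [] _ back = back
  Linked-join (_ ∷ []) (r ∷ [-]) back = r ∷ back
  Linked-join (_ ∷ x ∷ xs) (r ∷ front) back = r ∷ Linked-join (x ∷ xs) front back

  Linked-last : ∀ {x xs y} → Linked R (x ∷ xs ++ [ y ]) → ∃ λ z → z ∈ x ∷ xs × R z y
  Linked-last {xs = []} (r ∷ [-]) = _ , here refl , r
  Linked-last {xs = _ ∷ _} (_ ∷ walk) with Linked-last walk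
  ... | z , z∈ , r = z , there z∈ , r

flip : Fin 2 → Fin 2
flip zero = suc zero
flip (suc zero) = zero

≡-or-≡flip : ∀ i j → j ≡ i ⊎ j ≡ flip i
≡-or-≡flip zero zero = inj₁ refl
≡-or-≡flip zero (suc zero) = inj₂ refl
≡-or-≡flip (suc zero) zero = inj₂ refl
≡-or-≡flip (suc zero) (suc zero) = inj₁ refl

flip-≢ : ∀ j → flip j ≢ j
flip-≢ zero ()
flip-≢ (suc zero) ()

-- The outer rows 0 and 2 are indexed by Fin 2, so that flip also swaps them.
outerRow : Fin 2 → Fin 3
outerRow zero = zero
outerRow (suc zero) = suc (suc zero)

corner : Fin 2 → Fin 2 → Cell₃₂
corner s j = outerRow s , j

middle : Fin 2 → Cell₃₂
middle j = suc zero , j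

data CellView : Cell₃₂ → Set where
  isCorner : ∀ s j → CellView (corner s j)
  isMiddle : ∀ j → CellView (middle j)

cellView : ∀ x → CellView x
cellView (zero , j) = isCorner zero j
cellView (suc zero , j) = isMiddle j
cellView (suc (suc zero) , j) = isCorner (suc zero) j

corner≢middle : ∀ s j k → corner s j ≢ middle k
corner≢middle zero _ _ ()
corner≢middle (suc zero) _ _ ()

opposite-corners-differ : ∀ s j k → corner (flip s) k ≢ corner s j
opposite-corners-differ zero _ _ ()
opposite-corners-differ (suc zero) _ _ ()

unique-covering⇒length≡6 : ∀ {qs : List Cell₃₂} → Unique qs → (∀ x → x ∈ qs) → length qs ≡ 6
unique-covering⇒length≡6 distinct covering =
  ↭-length (∼bag⇒↭ (unique∧set⇒bag distinct (cartesianProduct⁺ (allFin⁺ 3) (allFin⁺ 2))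
    λ {x} → mk⇔ (λ _ → ∈-cartesianProduct⁺ (∈-allFin (proj₁ x)) (∈-allFin (proj₂ x))) (λ _ → covering x)))

GridAdj-sym : ∀ {m n} {x y : Cell m n} → GridAdj x y → GridAdj y x
GridAdj-sym {x = i , j} {i' , j'} = trans (cong₂ _+_ (∣-∣-comm (toℕ i') (toℕ i)) (∣-∣-comm (toℕ j') (toℕ j)))

Edge-sym : ∀ {m n} {Σ : Set} {c : Cell m n → Σ} {x y} → Edge c x y → Edge c y x
Edge-sym {x = x} {y} (adj , same) = GridAdj-sym {x = x} {y} adj , sym same

corner-neighbour : ∀ s j x → GridAdj (corner s j) x → x ≡ corner s (flip j) ⊎ x ≡ middle j
corner-neighbour zero zero (zero , suc zero) _ = inj₁ refl
corner-neighbour zero zero (suc zero , zero) _ = inj₂ refl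
corner-neighbour zero zero (zero , zero) ()
corner-neighbour zero zero (suc zero , suc zero) ()
corner-neighbour zero zero (suc (suc zero) , _) ()
corner-neighbour zero (suc zero) (zero , zero) _ = inj₁ refl
corner-neighbour zero (suc zero) (suc zero , suc zero) _ = inj₂ refl
corner-neighbour zero (suc zero) (zero , suc zero) ()
corner-neighbour zero (suc zero) (suc zero , zero) ()
corner-neighbour zero (suc zero) (suc (suc zero) , _) ()
corner-neighbour (suc zero) zero (suc (suc zero) , suc zero) _ = inj₁ refl
corner-neighbour (suc zero) zero (suc zero , zero) _ = inj₂ refl
corner-neighbour (suc zero) zero (suc (suc zero) , zero) ()
corner-neighbour (suc zero) zero (suc zero , suc zero) ()
corner-neighbour (suc zero) zero (zero , _) ()
corner-neighbour (suc zero) (suc zero) (suc (suc zero) , zero) _ = inj₁ refl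
corner-neighbour (suc zero) (suc zero) (suc zero , suc zero) _ = inj₂ refl
corner-neighbour (suc zero) (suc zero) (suc (suc zero) , suc zero) ()
corner-neighbour (suc zero) (suc zero) (suc zero , zero) ()
corner-neighbour (suc zero) (suc zero) (zero , _) ()

squareCells : Fin 2 → List Cell₃₂
squareCells s = corner s zero ∷ corner s (suc zero) ∷ middle (suc zero) ∷ middle zero ∷ []

squareCells-unique : ∀ s → Unique (squareCells s)
squareCells-unique s =
  ((λ ()) ∷ corner≢middle s _ _ ∷ corner≢middle s _ _ ∷ [])
  ∷ (corner≢middle s _ _ ∷ corner≢middle s _ _ ∷ []) ∷ ((λ ()) ∷ []) ∷ [] ∷ []

squareCells-walk : ∀ s → Linked GridAdj (squareCells s ∷ʳ corner s zero)
squareCells-walk zero = refl ∷ refl ∷ refl ∷ refl ∷ [-]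
squareCells-walk (suc zero) = refl ∷ refl ∷ refl ∷ refl ∷ [-]

module _ {Σ : Set} (c : Cell₃₂ → Σ) where

  CycleAt : Cell₃₂ → List Cell₃₂ → Set
  CycleAt v vs = 2 ≤ length vs × Unique (v ∷ vs) × Linked (Edge c) (v ∷ vs ++ [ v ])

  CycleThrough : Cell₃₂ → Set
  CycleThrough v = ∃ (CycleAt v)

  MonochromaticSquare : Fin 2 → Set
  MonochromaticSquare s = ∃ λ σ → ∀ j → c (corner s j) ≡ σ × c (middle j) ≡ σ

module _ {Σ : Set} {c : Cell₃₂ → Σ} where

  rotate : ∀ {v w} pre post → CycleAt c v (pre ++ w ∷ post) → CycleAt c w (post ++ v ∷ pre)
  rotate {v} {w} pre post (long , distinct , walk) =
    subst (2 ≤_) (suc-injective (↭-length swap)) long ,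
    Unique-resp-↭ (↭⇒↭ₛ swap) distinct ,
    subst (Linked (Edge c)) (cong (w ∷_) (sym (++-assoc post (v ∷ pre) [ w ])))
      (Linked-join (w ∷ post) (proj₂ halves) (proj₁ halves))
    where
      swap : v ∷ pre ++ w ∷ post ↭ w ∷ post ++ v ∷ pre
      swap = ++-comm (v ∷ pre) (w ∷ post)
      halves : Linked (Edge c) (v ∷ pre ++ [ w ]) × Linked (Edge c) (w ∷ post ++ [ v ])
      halves = Linked-split (v ∷ pre) (subst (Linked (Edge c)) (cong (v ∷_) (++-assoc pre (w ∷ post) [ v ])) walk)

  ∈⇒cycleThrough : ∀ {v vs w} → CycleAt c v vs → w ∈ v ∷ vs → CycleThrough c w
  ∈⇒cycleThrough cycle (here refl) = _ , cycle
  ∈⇒cycleThrough cycle (there w∈) with ∈-∃++ w∈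
  ... | pre , post , refl = _ , rotate pre post cycle

  cycle-neighbours : ∀ {v vs} → CycleAt c v vs →
                     ∃₂ λ u z → u ≢ z × u ∈ vs × z ∈ vs × Edge c v u × Edge c v z
  cycle-neighbours {v} {u ∷ _ ∷ _} (_ , (_ ∷ (u∉ ∷ _)) , (vu ∷ _ ∷ walk)) with Linked-last walk
  ... | z , z∈ , zv = u , z , All.lookup u∉ z∈ , here refl , there z∈ , vu , Edge-sym {x = z} {v} zv
  cycle-neighbours {vs = _ ∷ []} (s≤s () , _)

  corner-on-cycle : ∀ {s j} → CycleThrough c (corner s j) →
                    (c (corner s j) ≡ c (corner s (flip j)) × c (corner s j) ≡ c (middle j))
                    × CycleThrough c (corner s (flip j))
  corner-on-cycle {s} {j} (_ , cycle) with cycle-neighbours cycle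
  ... | u , z , u≢z , u∈ , z∈ , (u-adj , cu) , (z-adj , cz)
      with corner-neighbour s j u u-adj | corner-neighbour s j z z-adj
  ... | inj₁ refl | inj₁ refl = ⊥-elim (u≢z refl)
  ... | inj₁ refl | inj₂ refl = (cu , cz) , ∈⇒cycleThrough cycle (there u∈)
  ... | inj₂ refl | inj₁ refl = (cz , cu) , ∈⇒cycleThrough cycle (there z∈)
  ... | inj₂ refl | inj₂ refl = ⊥-elim (u≢z refl)

  cycleThrough-corner⇒monochromatic : ∀ {s j} → CycleThrough c (corner s j) → MonochromaticSquare c s
  cycleThrough-corner⇒monochromatic {s} {j} cycle = c (corner s j) , colour
    where
      colour : ∀ k → c (corner s k) ≡ c (corner s j) × c (middle k) ≡ c (corner s j)
      colour k with corner-on-cycle cycle | ≡-or-≡flip j k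
      ... | (_ , same-column) , _ | inj₁ refl = refl , sym same-column
      ... | (same-row , _) , mate-cycle | inj₂ refl =
        sym same-row , trans (sym (proj₂ (proj₁ (corner-on-cycle mate-cycle)))) (sym same-row)

  cycle-visits-corner : ∀ {v vs} → CycleAt c v vs → ∃₂ λ s j → corner s j ∈ v ∷ vs
  cycle-visits-corner {v} {u ∷ u' ∷ _} (_ , ((v≢u ∷ v≢u' ∷ _) ∷ (u≢u' ∷ _) ∷ _) , _)
      with cellView v | cellView u | cellView u'
  ... | isCorner s j | _ | _ = s , j , here refl
  ... | isMiddle _ | isCorner s j | _ = s , j , there (here refl)
  ... | isMiddle _ | isMiddle _ | isCorner s j = s , j , there (there (here refl))
  ... | isMiddle i | isMiddle j | isMiddle k with ≡-or-≡flip i j | ≡-or-≡flip i k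
  ...   | inj₁ refl | _ = ⊥-elim (v≢u refl)
  ...   | _ | inj₁ refl = ⊥-elim (v≢u' refl)
  ...   | inj₂ refl | inj₂ refl = ⊥-elim (u≢u' refl)
  cycle-visits-corner {vs = _ ∷ []} (s≤s () , _)

  cycle⇒monochromaticSquare : HasCycle c → ∃ (MonochromaticSquare c)
  cycle⇒monochromaticSquare (_ , _ , cycle) with cycle-visits-corner cycle
  ... | s , _ , corner∈ = s , cycleThrough-corner⇒monochromatic (∈⇒cycleThrough cycle corner∈)

  monochromatic-walk : ∀ {σ xs} → All (λ x → c x ≡ σ) xs → Linked GridAdj xs → Linked (Edge c) xs
  monochromatic-walk [] [] = []
  monochromatic-walk (_ ∷ []) [-] = [-]
  monochromatic-walk (cx ∷ cy ∷ cs) (adj ∷ walk) = (adj , trans cx (sym cy)) ∷ monochromatic-walk (cy ∷ cs) walk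

  monochromaticSquare⇒cycle : ∀ s → MonochromaticSquare c s → HasCycle c
  monochromaticSquare⇒cycle s (_ , colour) =
    corner s zero , _ , s≤s (s≤s z≤n) , squareCells-unique s ,
    monochromatic-walk (proj₁ (colour zero) ∷ proj₁ (colour (suc zero)) ∷ proj₂ (colour (suc zero))
                        ∷ proj₂ (colour zero) ∷ proj₁ (colour zero) ∷ [])
                       (squareCells-walk s)

History : Set → Set
History Σ = List (Cell₃₂ × Σ)

keys : ∀ {Σ} → History Σ → List Cell₃₂
keys = map proj₁

_≟_ : DecidableEquality Cell₃₂
_≟_ = ≡-dec Fin._≟_ Fin._≟_

open import Data.List.Membership.DecPropositional _≟_ using (_∈?_)

module _ {Σ : Set} where

  Queried : History Σ → Cell₃₂ → Set
  Queried h x = x ∈ keys h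

  Full : History Σ → Fin 2 → Set
  Full h s = ∀ j → Queried h (corner s j)

  AnsweredOnly : Σ → History Σ → Cell₃₂ → Set
  AnsweredOnly σ h x = ∀ {τ} → (x , τ) ∈ h → τ ≡ σ

  queried? : ∀ h x → Dec (Queried h x)
  queried? h x = x ∈? keys h

  full? : ∀ h s → Dec (Full h s)
  full? h s = all? (λ j → queried? h (corner s j))

  everything-queried : ∀ {h s} → Full h s → Full h (flip s) → (∀ k → Queried h (middle k)) → ∀ x → Queried h x
  everything-queried {s = s} full full′ middles x with cellView x
  ... | isMiddle k = middles k
  ... | isCorner t k with ≡-or-≡flip s t
  ...   | inj₁ refl = full k
  ...   | inj₂ refl = full′ k

  keys-∷ʳ : ∀ h (e : Cell₃₂ × Σ) → keys (h ∷ʳ e) ≡ keys h ∷ʳ proj₁ e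
  keys-∷ʳ h e = map-++ proj₁ h [ e ]

  Queried-∷ʳ⁺ : ∀ {h e x} → Queried h x → Queried (h ∷ʳ e) x
  Queried-∷ʳ⁺ {h} {e} q rewrite keys-∷ʳ h e = ∈-++⁺ˡ q

  Queried-∷ʳ-new : ∀ {h y τ} → Queried (h ∷ʳ (y , τ)) y
  Queried-∷ʳ-new {h} {y} {τ} rewrite keys-∷ʳ h (y , τ) = ∈-++⁺ʳ (keys h) (here refl)

  Queried-∷ʳ⁻ : ∀ {h y τ x} → Queried (h ∷ʳ (y , τ)) x → Queried h x ⊎ x ≡ y
  Queried-∷ʳ⁻ {h} {y} {τ} q rewrite keys-∷ʳ h (y , τ) with ∈-++⁻ (keys h) q
  ... | inj₁ old = inj₁ old
  ... | inj₂ (here refl) = inj₂ refl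

  Full-∷ʳ⁺ : ∀ {h e s} → Full h s → Full (h ∷ʳ e) s
  Full-∷ʳ⁺ full j = Queried-∷ʳ⁺ (full j)

  Full-∷ʳ-completing : ∀ {h s j τ} → Queried h (corner s (flip j)) → Full (h ∷ʳ (corner s j , τ)) s
  Full-∷ʳ-completing {j = j} mate k with ≡-or-≡flip j k
  ... | inj₁ refl = Queried-∷ʳ-new
  ... | inj₂ refl = Queried-∷ʳ⁺ mate

  Full-∷ʳ-elsewhere : ∀ {h y τ s} → (∀ k → corner s k ≢ y) → Full (h ∷ʳ (y , τ)) s → Full h s
  Full-∷ʳ-elsewhere elsewhere full k with Queried-∷ʳ⁻ (full k)
  ... | inj₁ old = old
  ... | inj₂ new = ⊥-elim (elsewhere k new)

  Full-∷ʳ-mate : ∀ {h s j τ} → Full (h ∷ʳ (corner s j , τ)) s → Queried h (corner s (flip j))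
  Full-∷ʳ-mate {j = j} full with Queried-∷ʳ⁻ (full (flip j))
  ... | inj₁ old = old
  ... | inj₂ same = ⊥-elim (flip-≢ j (cong proj₂ same))

  AnsweredOnly-∷ʳ : ∀ {σ h x y τ} → AnsweredOnly σ h x → (x ≡ y → τ ≡ σ) → AnsweredOnly σ (h ∷ʳ (y , τ)) x
  AnsweredOnly-∷ʳ {h = h} old new x∈ with ∈-++⁻ h x∈
  ... | inj₁ x∈h = old x∈h
  ... | inj₂ (here refl) = new refl

  completeWith : (Cell₃₂ → Σ) → History Σ → Cell₃₂ → Σ
  completeWith d [] x = d x
  completeWith d ((y , σ) ∷ h) x with x ≟ y
  ... | yes _ = σ
  ... | no _ = completeWith d h x

  completeWith-head : ∀ {d h y σ} → completeWith d ((y , σ) ∷ h) y ≡ σ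
  completeWith-head {y = y} with y ≟ y
  ... | yes _ = refl
  ... | no y≢y = ⊥-elim (y≢y refl)

  completeWith-skip : ∀ {d h x y σ} → x ≢ y → completeWith d ((y , σ) ∷ h) x ≡ completeWith d h x
  completeWith-skip {x = x} {y} x≢y with x ≟ y
  ... | yes x≡y = ⊥-elim (x≢y x≡y)
  ... | no _ = refl

  completeWith-extends : ∀ {d h} → Unique (keys h) → Extends (completeWith d h) h
  completeWith-extends {h = []} [] = []
  completeWith-extends {d} {(y , σ) ∷ h} (y∉ ∷ distinct) =
    completeWith-head {d} {h} {y} ∷
    All.zipWith (λ (y≢x , answer) → trans (completeWith-skip (y≢x ∘ sym)) answer)
                (All.map⁻ y∉ , completeWith-extends distinct)

  completeWith-unqueried : ∀ {d h x} → ¬ Queried h x → completeWith d h x ≡ d x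
  completeWith-unqueried {h = []} _ = refl
  completeWith-unqueried {h = (y , _) ∷ _} {x} unqueried with x ≟ y
  ... | yes x≡y = ⊥-elim (unqueried (here x≡y))
  ... | no _ = completeWith-unqueried (unqueried ∘ there)

  completeWith-queried : ∀ {d h x σ} → Unique (keys h) → Queried h x → AnsweredOnly σ h x →
                         completeWith d h x ≡ σ
  completeWith-queried distinct q answered with ∈-map⁻ proj₁ q
  ... | _ , p∈ , refl = trans (All.lookup (completeWith-extends distinct) p∈) (answered p∈)

  completeWith-answered : ∀ {d h x σ} → Unique (keys h) → AnsweredOnly σ h x → d x ≡ σ →
                          completeWith d h x ≡ σ
  completeWith-answered {h = h} {x} distinct answered default with queried? h x
  ... | yes q = completeWith-queried distinct q answered
  ... | no unqueried = trans (completeWith-unqueried unqueried) default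

keys-runFrom : ∀ {Σ} (A : Adversary Σ) h qs → keys (runFrom A h qs) ≡ keys h ++ qs
keys-runFrom A h [] = sym (++-identityʳ (keys h))
keys-runFrom A h (q ∷ qs) = begin
  keys (runFrom A (h ∷ʳ (q , A h q)) qs) ≡⟨ keys-runFrom A (h ∷ʳ (q , A h q)) qs ⟩
  keys (h ∷ʳ (q , A h q)) ++ qs          ≡⟨ cong (_++ qs) (keys-∷ʳ h (q , A h q)) ⟩
  (keys h ∷ʳ q) ++ qs                    ≡⟨ ++-assoc (keys h) [ q ] qs ⟩
  keys h ++ q ∷ qs                       ∎
  where open ≡-Reasoning

module _ {Σ : Set} (a b : Σ) where

  Spoils : History Σ → Fin 2 → Fin 2 → Set
  Spoils h s j = Queried h (corner s (flip j)) × ¬ Full h (flip s)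

  spoils? : ∀ h s j → Dec (Spoils h s j)
  spoils? h s j = queried? h (corner s (flip j)) ×-dec ¬? (full? h (flip s))

  cornerAnswer : History Σ → Fin 2 → Fin 2 → Σ
  cornerAnswer h s j = if does (spoils? h s j) then b else a

  adversary : Adversary Σ
  adversary h x with cellView x
  ... | isMiddle _ = a
  ... | isCorner s j = cornerAnswer h s j

  data Invariant (h : History Σ) : Set where
    unspoiled : (∀ x → AnsweredOnly a h x) → (∀ s → Full h s → Full h (flip s)) → Invariant h
    spoiled : ∀ s j → (corner s j , b) ∈ h → Full h s →
              (∀ k → AnsweredOnly a h (middle k)) → (∀ k → AnsweredOnly a h (corner (flip s) k)) →
              Invariant h

  initial : Invariant []
  initial = unspoiled (λ _ ()) (λ _ full → contradiction (full zero) λ ())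

  invariant-answer-a : ∀ {h y} → Invariant h → (∀ s → Full (h ∷ʳ (y , a)) s → Full h s ⊎ Full h (flip s)) →
                       Invariant (h ∷ʳ (y , a))
  invariant-answer-a (unspoiled clean balanced) completes =
    unspoiled (λ x → AnsweredOnly-∷ʳ (clean x) (λ _ → refl))
              (λ s full → Full-∷ʳ⁺ (either (balanced s) id (completes s full)))
  invariant-answer-a (spoiled s j b∈ full middles opposite) _ =
    spoiled s j (∈-++⁺ˡ b∈) (Full-∷ʳ⁺ full)
            (λ k → AnsweredOnly-∷ʳ (middles k) (λ _ → refl))
            (λ k → AnsweredOnly-∷ʳ (opposite k) (λ _ → refl))

  invariant-answer-b : ∀ {h s j} → Invariant h → Spoils h s j → Invariant (h ∷ʳ (corner s j , b))
  invariant-answer-b {h} {s} {j} (unspoiled clean _) (mate , _) =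
    spoiled s j (∈-++⁺ʳ h (here refl)) (Full-∷ʳ-completing mate)
            (λ k → AnsweredOnly-∷ʳ (clean _) (⊥-elim ∘ corner≢middle s j k ∘ sym))
            (λ k → AnsweredOnly-∷ʳ (clean _) (⊥-elim ∘ opposite-corners-differ s j k))
  invariant-answer-b {s = s} {j} (spoiled t k b∈ full middles opposite) (_ , incomplete) with ≡-or-≡flip s t
  ... | inj₁ refl =
    spoiled s k (∈-++⁺ˡ b∈) (Full-∷ʳ⁺ full)
            (λ i → AnsweredOnly-∷ʳ (middles i) (⊥-elim ∘ corner≢middle s j i ∘ sym))
            (λ i → AnsweredOnly-∷ʳ (opposite i) (⊥-elim ∘ opposite-corners-differ s j i))
  ... | inj₂ refl = ⊥-elim (incomplete full)

  -- Stated through dec-true/dec-false: does (spoils? h s j) unfolds, so `with` cannot abstract it.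
  cornerAnswer-cases : ∀ h s j → Spoils h s j × cornerAnswer h s j ≡ b ⊎ ¬ Spoils h s j × cornerAnswer h s j ≡ a
  cornerAnswer-cases h s j with spoils? h s j
  ... | yes spoils = inj₁ (spoils , cong (λ t → if t then b else a) (dec-true (spoils? h s j) spoils))
  ... | no ¬spoils = inj₂ (¬spoils , cong (λ t → if t then b else a) (dec-false (spoils? h s j) ¬spoils))

  unspoiling-completion : ∀ {h s j τ} → ¬ Spoils h s j →
                          ∀ t → Full (h ∷ʳ (corner s j , τ)) t → Full h t ⊎ Full h (flip t)
  unspoiling-completion {h} {s} {j} ¬spoils t full with ≡-or-≡flip s t
  ... | inj₁ refl = inj₂ (decidable-stable (full? h (flip s)) (λ incomplete → ¬spoils (Full-∷ʳ-mate full , incomplete)))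
  ... | inj₂ refl = inj₁ (Full-∷ʳ-elsewhere (opposite-corners-differ s j) full)

  invariant-answer-corner : ∀ {h s j} → Invariant h → Invariant (h ∷ʳ (corner s j , cornerAnswer h s j))
  invariant-answer-corner {h} {s} {j} inv with cornerAnswer h s j | cornerAnswer-cases h s j
  ... | _ | inj₁ (spoils , refl) = invariant-answer-b inv spoils
  ... | _ | inj₂ (¬spoils , refl) = invariant-answer-a inv (unspoiling-completion ¬spoils)

  invariant-step : ∀ {h} q → Invariant h → Invariant (h ∷ʳ (q , adversary h q))
  invariant-step q inv with cellView q
  ... | isMiddle k = invariant-answer-a inv (λ s full → inj₁ (Full-∷ʳ-elsewhere (λ j → corner≢middle s j k) full))
  ... | isCorner s j = invariant-answer-corner inv

  runFrom-invariant : ∀ {h} qs → Invariant h → Invariant (runFrom adversary h qs)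
  runFrom-invariant [] inv = inv
  runFrom-invariant (q ∷ qs) inv = runFrom-invariant qs (invariant-step q inv)

  middle-answered : ∀ {h} → Invariant h → ∀ k → AnsweredOnly a h (middle k)
  middle-answered (unspoiled clean _) k = clean (middle k)
  middle-answered (spoiled _ _ _ _ middles _) = middles

  clean-row : ∀ {h} → Invariant h → ∃ λ s → ∀ j → AnsweredOnly a h (corner s j)
  clean-row (unspoiled clean _) = zero , λ j → clean (corner zero j)
  clean-row (spoiled s _ _ _ _ opposite) = flip s , opposite

  clean-full-row : ∀ {h s} → a ≢ b → Invariant h → Full h s → (∀ j → AnsweredOnly a h (corner s j)) →
                   Full h (flip s)
  clean-full-row _ (unspoiled _ balanced) full _ = balanced _ full
  clean-full-row {s = s} a≢b (spoiled t j b∈ full-t _ _) _ clean with ≡-or-≡flip s t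
  ... | inj₁ refl = ⊥-elim (a≢b (sym (clean j b∈)))
  ... | inj₂ refl = full-t

  cyclic-extension : ∀ {h} → Unique (keys h) → Invariant h → Σ[ c ∈ (Cell₃₂ → Σ) ] (Extends c h × HasCycle c)
  cyclic-extension {h} distinct inv with clean-row inv
  ... | s , clean =
    completeWith (λ _ → a) h , completeWith-extends distinct ,
    monochromaticSquare⇒cycle s (a , λ j → completeWith-answered distinct (clean j) refl ,
                                           completeWith-answered distinct (middle-answered inv j) refl)

  -- The extra entry (middle k , b) colours the unread cell middle k with b.
  acyclic-extension-by-middle : ∀ {h} k → a ≢ b → Unique (keys h) → Invariant h → ¬ Queried h (middle k) →
                                Σ[ c ∈ (Cell₃₂ → Σ) ] (Extends c h × Acyclic c)
  acyclic-extension-by-middle {h} k a≢b distinct inv unqueried =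
    c , All.tail extends , acyclic
    where
      c : Cell₃₂ → Σ
      c = completeWith (λ _ → a) ((middle k , b) ∷ h)
      extends : Extends c ((middle k , b) ∷ h)
      extends = completeWith-extends (All.¬Any⇒All¬ (keys h) unqueried ∷ distinct)
      other-middle : c (middle (flip k)) ≡ a
      other-middle = trans (completeWith-skip {h = h} {y = middle k} {b} (flip-≢ k ∘ cong proj₂))
                           (completeWith-answered {d = λ _ → a} distinct (middle-answered inv (flip k)) refl)
      acyclic : Acyclic c
      acyclic cycle with cycle⇒monochromaticSquare cycle
      ... | _ , _ , colour =
        a≢b (trans (sym other-middle) (trans (proj₂ (colour (flip k))) (trans (sym (proj₂ (colour k))) (All.head extends))))

  acyclic-extension-by-corners : ∀ {h} → a ≢ b → Unique (keys h) → Invariant h → ¬ (∀ x → Queried h x) →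
                                 (∀ k → Queried h (middle k)) → Σ[ c ∈ (Cell₃₂ → Σ) ] (Extends c h × Acyclic c)
  acyclic-extension-by-corners {h} a≢b distinct inv incomplete middles =
    c , extends , acyclic
    where
      c : Cell₃₂ → Σ
      c = completeWith (λ _ → b) h
      extends : Extends c h
      extends = completeWith-extends distinct
      -- A monochromatic square s would force row s to be read and answered a only,
      -- hence (by the invariant) every cell to be read.
      acyclic : Acyclic c
      acyclic cycle with cycle⇒monochromaticSquare cycle
      ... | s , _ , colour = incomplete (everything-queried full (clean-full-row a≢b inv full clean) middles)
        where
          corner-a : ∀ j → c (corner s j) ≡ a
          corner-a j = trans (proj₁ (colour j))
                             (trans (sym (proj₂ (colour j))) (completeWith-queried distinct (middles j) (middle-answered inv j)))
          full : Full h s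
          full j = decidable-stable (queried? h (corner s j))
                                    (λ unqueried → a≢b (trans (sym (corner-a j)) (completeWith-unqueried unqueried)))
          clean : ∀ j → AnsweredOnly a h (corner s j)
          clean j τ∈ = trans (sym (All.lookup extends τ∈)) (corner-a j)

  acyclic-extension : ∀ {h} → a ≢ b → Unique (keys h) → Invariant h → ¬ (∀ x → Queried h x) →
                      Σ[ c ∈ (Cell₃₂ → Σ) ] (Extends c h × Acyclic c)
  acyclic-extension {h} a≢b distinct inv incomplete
    with queried? h (middle zero) | queried? h (middle (suc zero))
  ... | no unqueried | _ = acyclic-extension-by-middle zero a≢b distinct inv unqueried
  ... | _ | no unqueried = acyclic-extension-by-middle (suc zero) a≢b distinct inv unqueried
  ... | yes q₀ | yes q₁ = acyclic-extension-by-corners a≢b distinct inv incomplete λ { zero → q₀ ; (suc zero) → q₁ }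

  run-extensions : a ≢ b → ∀ qs → Unique qs → length qs < 6 →
                   (Σ[ c ∈ (Cell₃₂ → Σ) ] (Extends c (run adversary qs) × HasCycle c))
                   × (Σ[ c ∈ (Cell₃₂ → Σ) ] (Extends c (run adversary qs) × Acyclic c))
  run-extensions a≢b qs distinct short =
    cyclic-extension distinct′ invariant , acyclic-extension a≢b distinct′ invariant incomplete
    where
      keys≡qs : keys (run adversary qs) ≡ qs
      keys≡qs = keys-runFrom adversary [] qs
      distinct′ : Unique (keys (run adversary qs))
      distinct′ = subst Unique (sym keys≡qs) distinct
      invariant : Invariant (run adversary qs)
      invariant = runFrom-invariant qs initial
      incomplete : ¬ (∀ x → Queried (run adversary qs) x)
      incomplete queried = <⇒≢ short (unique-covering⇒length≡6 distinct (λ x → subst (x ∈_) keys≡qs (queried x)))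

lemma4 : (Σ : Set) (a b : Σ) → a ≢ b →
    Σ[ A ∈ Adversary Σ ]
      ((qs : List Cell₃₂) → Unique qs → 1 ≤ length qs → length qs < 6 →
        (Σ[ c ∈ (Cell₃₂ → Σ) ] (Extends c (run A qs) × HasCycle c))
        × (Σ[ c ∈ (Cell₃₂ → Σ) ] (Extends c (run A qs) × Acyclic c)))
lemma4 _ a b a≢b = adversary a b , λ qs distinct _ short → run-extensions a b a≢b qs distinct short
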